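{- Let $\sum_{i=1}^n a_ix_i\leqslant a_0$ be a linear integer constraint with nonnegative integer coefficients and integer variables $x_i\in[0,d_i]$, let $b>1$, and let $m$ be such that $\sum_i a_id_i<b^{m+1}$ and $0\le a_0<b^{m+1}$. Write $a_i=\sum_{j=0}^m b^jA_{ij}$ and $a_0=\sum_{j=0}^m b^j\varepsilon_j$ with $0\le A_{ij},\varepsilon_j<b$. Let $v_i\in[0,d_i]$ satisfy $\sum_{j=0}^m\sum_{i=1}^n b^jA_{ij}v_i=\sum_{j=0}^m b^j\varepsilon_j$, and let $A$ be the partial assignment setting $x_i^k$ true for all $i$ and $1\le k\le v_i$. Then unit propagation on the SN-Opt encoding (described in the context) together with $A$ assigns: (1) $o_j^{\varepsilon_j}$ to true for every $0\le j\le m$ with $\varepsilon_j>0$; (2) $o_j^{\varepsilon_j+1}$ to false for every $0\le j\le m$ with $\varepsilon_j<b-1$; (3) $x_i^{v_i+1}$ to false for every $1\le i\le n$ with $A_{ij}\neq0$ for some $j$ and $v_i<d_i$.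
   Context: Order encoding: Boolean variables $x_i^k$ ($1\le k\le d_i$) meaning $x_i\ge k$, with clauses $x_i^{k+1}\rightarrow x_i^k$. Sorting network encoding $\mathrm{sn}$: for literals $u_1,\dots,u_N$ (repetitions allowed), $\mathrm{sn}(u_1,\dots,u_N)$ introduces outputs $w_1,\dots,w_N$ and a CNF formula such that in every satisfying assignment $w_k$ is true iff at least $k$ inputs are true, and unit propagation on it is domain consistent for the relation $\{(u,w)\in\{0,1\}^{2N}: w_k=1\iff|\{l:u_l=1\}|\ge k\}$. Let $X_{i,j}$ be the list $x_i^1$ repeated $A_{ij}$ times, then $x_i^2$ repeated $A_{ij}$ times, ..., then $x_i^{d_i}$ repeated $A_{ij}$ times. Define $(y_0^1,\dots,y_0^{e_0})=\mathrm{sn}(X_{1,0},\dots,X_{n,0})$ and for $1\le j\le m$: $(y_j^1,\dots,y_j^{e_j})=\mathrm{sn}(y_{j-1}^b,y_{j-1}^{2b},\dots,y_{j-1}^{b\lfloor e_{j-1}/b\rfloor},X_{1,j},\dots,X_{n,j})$; $y_j^l$ for $l>e_j$ denotes the constant false. For $0\le j\le m$, $1\le k<b$, introduce $o_j^k$ defined (via the standard Tseytin clauses: for each conjunction $t\leftrightarrow p\wedge q$ the clauses $\neg t\lor p$, $\neg t\lor q$, $t\lor\neg p\lor\neg q$, and for $o\leftrightarrow\bigvee_l t_l$ the clauses $\neg o\lor\bigvee_l t_l$ and $o\lor\neg t_l$) by $o_j^k\leftrightarrow\bigvee_{1\le l\le e_j,\ l\equiv k\ (\mathrm{mod}\ b)}\big(y_j^l\wedge\neg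 y_j^{l+b-k}\big)$. The SN-Opt encoding consists of the order-encoding clauses, the network clauses, these Tseytin clauses, and, for every $0\le j_1\le m$ with $\varepsilon_{j_1}<b-1$, the clause $\neg o_{j_1}^{\varepsilon_{j_1}+1}\lor\bigvee_{j_1<j_2\le m,\ \varepsilon_{j_2}>0}\neg o_{j_2}^{\varepsilon_{j_2}}$. -}

module Defs where

open import Data.Nat using (ℕ; zero; suc; _+_; _*_; _∸_; _^_; _≤_; _<_; NonZero; _≤ᵇ_; _<ᵇ_; _≡ᵇ_)
open import Data.Nat.DivMod using (_/_; _%_)
open import Data.Fin using (Fin)
open import Data.Bool using (Bool; true; false; not; if_then_else_; _∧_)
open import Data.List using (List; []; _∷_; _++_; map; concat; concatMap; replicate; length; upTo; allFin; filterᵇ)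
open import Data.Nat.ListAction using (sum)
open import Data.List.Membership.Propositional using (_∈_)
open import Data.List.Relation.Unary.All using (All)
open import Data.List.Relation.Unary.Any using (Any)
open import Data.Product using (Σ; ∃; _×_)
open import Data.Sum using (_⊎_)
open import Relation.Binary.PropositionalEquality using (_≡_; _≢_)
open import Function.Bundles using (_⇔_)

data Lit (V : Set) : Set where
  pos : V → Lit V
  neg : V → Lit V

varOf : ∀ {V} → Lit V → V
varOf (pos x) = x
varOf (neg x) = x

negate : ∀ {V} → Lit V → Lit V
negate (pos x) = neg x
negate (neg x) = pos x

Clause : Set → Set
Clause V = List (Lit V)

CNF : Set → Set
CNF V = List (Clause V)

evalLit : ∀ {V} → (V → Bool) → Lit V → Bool
evalLit σ (pos x) = σ x
evalLit σ (neg x) = not (σ x)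

_⊨ˡ_ : ∀ {V} → (V → Bool) → Lit V → Set
σ ⊨ˡ l = evalLit σ l ≡ true

_⊨ᶜ_ : ∀ {V} → (V → Bool) → Clause V → Set
σ ⊨ᶜ C = Any (σ ⊨ˡ_) C

_⊨_ : ∀ {V} → (V → Bool) → CNF V → Set
σ ⊨ F = All (σ ⊨ᶜ_) F

-- a partial assignment is a list of literals (those set true);
-- σ extends α
_⊨ᵃ_ : ∀ {V} → (V → Bool) → List (Lit V) → Set
σ ⊨ᵃ α = All (σ ⊨ˡ_) α

countTrue : ∀ {V} → (V → Bool) → List (Lit V) → ℕ
countTrue σ [] = 0
countTrue σ (l ∷ ls) = (if evalLit σ l then 1 else 0) + countTrue σ ls

-- UP F α ⊢ l : unit propagation on F starting from the partial
-- assignment α assigns literal l true.  A conflict (some literal and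
-- its negation both assigned) counts as assigning every literal.
data UP_,_⊢_ {V : Set} (F : CNF V) (α : List (Lit V)) : Lit V → Set where
  given    : ∀ {l} → l ∈ α → UP F , α ⊢ l
  unit     : ∀ {l C} → C ∈ F → l ∈ C →
             (∀ l′ → l′ ∈ C → l′ ≢ l → UP F , α ⊢ negate l′) →
             UP F , α ⊢ l
  conflict : ∀ {l} l′ → UP F , α ⊢ l′ → UP F , α ⊢ negate l′ → UP F , α ⊢ l

range1 : ℕ → List ℕ
range1 k = map suc (upTo k)

sumTo : ℕ → (ℕ → ℕ) → ℕ
sumTo m f = sum (map f (upTo (suc m)))

sumFin : (n : ℕ) → (Fin n → ℕ) → ℕ
sumFin n f = sum (map f (allFin n))

-- Variables of the SN-Opt encoding.
--   xv i k  : x_i^k  (order encoding)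
--   yv j l  : y_j^l  (outputs of the j-th sorting network)
--   ov j k  : o_j^k
--   tv j l  : Tseytin variable for  y_j^l ∧ ¬ y_j^{l+b-k}  (k ≡ l mod b)
--   aux j w : auxiliary (fresh) variables of the j-th sorting network

data Var (n : ℕ) (W : Set) : Set where
  xv  : Fin n → ℕ → Var n W
  yv  : ℕ → ℕ → Var n W
  ov  : ℕ → ℕ → Var n W
  tv  : ℕ → ℕ → Var n W
  aux : ℕ → W → Var n W

-- The encoding.  Parameters: n variables with domains [0, d i],
-- base b, digits A i j of the coefficients, digits ε j of a₀, and the
-- type W of auxiliary variables of the sorting networks.

module SNOpt (n b m : ℕ) {{_ : NonZero b}} (d : Fin n → ℕ)
             (A : Fin n → ℕ → ℕ) (ε : ℕ → ℕ) (W : Set) where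

  V : Set
  V = Var n W

  L : Set
  L = Lit V

  X : Fin n → ℕ → List L
  X i j = concatMap (λ k → replicate (A i j) (pos (xv i k))) (range1 (d i))

  Xs : ℕ → List L
  Xs j = concat (map (λ i → X i j) (allFin n))

  inputs : ℕ → List L
  inputs zero    = Xs zero
  inputs (suc j) = map (λ l → pos (yv j (b * l))) (range1 (length (inputs j) / b))
                   ++ Xs (suc j)

  e : ℕ → ℕ
  e j = length (inputs j)

  SortRel : ℕ → (V → Bool) → Set
  SortRel j σ = ∀ k → 1 ≤ k → k ≤ e j → (σ (yv j k) ≡ true ⇔ k ≤ countTrue σ (inputs j))

  InScope : ℕ → V → Set
  InScope j x = Any (λ l → varOf l ≡ x) (inputs j)
              ⊎ Σ ℕ (λ k → 1 ≤ k × k ≤ e j × x ≡ yv j k)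

  record IsSN (j : ℕ) (F : CNF V) : Set₁ where
    field
      vars    : ∀ C → C ∈ F → ∀ l → l ∈ C →
                InScope j (varOf l) ⊎ Σ W (λ w → varOf l ≡ aux j w)
      sorts   : ∀ σ → σ ⊨ F → SortRel j σ
      domCons : ∀ (α : List L) → All (λ l → InScope j (varOf l)) α →
                ∀ (l : L) → InScope j (varOf l) →
                (∀ σ → σ ⊨ᵃ α → SortRel j σ → σ ⊨ˡ l) →
                UP F , α ⊢ l

  orderClauses : CNF V
  orderClauses = concatMap (λ i → map (λ k → neg (xv i (suc k)) ∷ pos (xv i k) ∷ [])
                                      (range1 (d i ∸ 1)))
                           (allFin n)

  idx : ℕ → ℕ → List ℕ
  idx j k = filterᵇ (λ l → (l % b) ≡ᵇ (k % b)) (range1 (e j))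

  -- Tseytin clauses for t ↔ y_j^l ∧ ¬ y_j^{l+b-k}, where y_j^{l'} for
  -- l' > e_j is the constant false (clauses simplified accordingly:
  -- satisfied clauses dropped, false literals removed)
  conjClauses : ℕ → ℕ → ℕ → CNF V
  conjClauses j k l =
    (neg (tv j l) ∷ pos (yv j l) ∷ []) ∷
    (if (l + b ∸ k) ≤ᵇ e j
     then (neg (tv j l) ∷ neg (yv j (l + b ∸ k)) ∷ []) ∷
          (pos (tv j l) ∷ neg (yv j l) ∷ pos (yv j (l + b ∸ k)) ∷ []) ∷ []
     else (pos (tv j l) ∷ neg (yv j l) ∷ []) ∷ [])

  oClauses : ℕ → ℕ → CNF V
  oClauses j k =
    concatMap (conjClauses j k) (idx j k)
    ++ (neg (ov j k) ∷ map (λ l → pos (tv j l)) (idx j k))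
    ∷ map (λ l → pos (ov j k) ∷ neg (tv j l) ∷ []) (idx j k)

  tseytinClauses : CNF V
  tseytinClauses = concatMap (λ j → concatMap (oClauses j) (range1 (b ∸ 1))) (upTo (suc m))

  finalClause : ℕ → Clause V
  finalClause j₁ = neg (ov j₁ (suc (ε j₁)))
                 ∷ map (λ j₂ → neg (ov j₂ (ε j₂)))
                       (filterᵇ (λ j₂ → (j₁ <ᵇ j₂) ∧ (0 <ᵇ ε j₂)) (upTo (suc m)))

  finalClauses : CNF V
  finalClauses = map finalClause (filterᵇ (λ j₁ → suc (ε j₁) <ᵇ b) (upTo (suc m)))

  snOpt : (ℕ → CNF V) → CNF V
  snOpt nets = orderClauses ++ concatMap nets (upTo (suc m))
               ++ tseytinClauses ++ finalClauses

  assignA : (Fin n → ℕ) → List L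
  assignA v = concatMap (λ i → map (λ k → pos (xv i k)) (range1 (v i))) (allFin n)

{-# OPTIONS --safe #-}
module Submission where

-- Let s_j be the carries of the balance equation read as a column addition in base b
-- (s_0 = Σ_i A_i0 v_i, s_{j+1} = ⌊s_j / b⌋ + Σ_i A_i(j+1) v_i). Under the assignment v,
-- network j has exactly s_j true inputs, and uniqueness of base-b digits gives s_j ≡ ε_j (mod b).
-- Domain consistency of the networks lets unit propagation set y_j^l for l ≤ s_j. Going down
-- from j = m, it then refutes y_j^{b(⌊s_j/b⌋+1)} = y_j^{s_j+b-ε_j}: for j = m that output does not
-- exist because e_m < b, and for j < m it is a false input of network j+1, which is refuted once
-- network j+1 has s_{j+1} true inputs and y_{j+1}^{s_{j+1}+1} false. With y_j^{s_j} true and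
-- y_j^{s_j+b-ε_j} false, the Tseytin clauses make o_j^{ε_j} true; the final clause then makes
-- o_j^{ε_j+1} false, hence y_j^{s_j+1} false, and every false input of network j (in particular
-- x_i^{v_i+1}) is refuted through the network.

import Data.Bool as Bool
open import Data.Bool using (Bool; true; false; not; if_then_else_; T?; _∧_)
open import Data.Bool.Properties using (not-involutive; not-¬; T-≡; T-∧)
open import Data.Empty using (⊥-elim)
open import Data.Fin using (Fin)
open import Data.List
  using (List; []; _∷_; _++_; filter; filterᵇ; map; concatMap; replicate; upTo; applyUpTo; length; allFin)
open import Data.List.Membership.Propositional using (_∈_)
open import Data.List.Membership.Propositional.Properties
  using (∈-map⁺; ∈-map⁻; ∈-upTo⁺; ∈-upTo⁻; ∈-++⁺ˡ; ∈-++⁺ʳ; ∈-++⁻; ∈-concat⁺′; ∈-concat⁻′;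
         ∈-filter⁺; ∈-filter⁻; ∈-allFin)
open import Data.List.Properties
  using (map-cong; map-++; map-∘; upTo-∷ʳ; map-upTo; length-map; length-upTo; length-++)
open import Data.List.Relation.Unary.All as All using (All; []; _∷_)
import Data.List.Relation.Unary.All.Properties as All
open import Data.List.Relation.Unary.Any as Any using (here; there)
open import Data.Nat
  using (ℕ; zero; suc; _+_; _*_; _^_; _∸_; _⊓_; _≤_; _<_; _≤ᵇ_; _<ᵇ_; _≡ᵇ_; _≤?_; _<?_;
         z≤n; s≤s; s≤s⁻¹; NonZero; >-nonZero⁻¹)
open import Data.Nat.DivMod
  using (_/_; _%_; m≡m%n+[m/n]*n; [m+kn]%n≡m%n; m<n⇒m%n≡m; m%n<n; m%n≤m; m/n≡0⇒m<n;
         m*n/n≡m; /-monoˡ-≤; m/n*n≤m)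
open import Data.Nat.ListAction using (sum)
open import Data.Nat.ListAction.Properties using (sum-++)
open import Data.Nat.Properties
open import Algebra.Properties.CommutativeSemigroup +-commutativeSemigroup using (interchange)
open import Data.Nat.Tactic.RingSolver using (solve-∀)
open import Data.Product using (Σ; _×_; _,_; proj₁)
open import Data.Sum using (_⊎_; inj₁; inj₂)
open import Defs
open import Function using (_∘_; Equivalence)
open import Relation.Binary.PropositionalEquality
open import Relation.Nullary using (¬_; Dec; yes; no; contradiction)
open import Relation.Nullary.Reflects using (det; ofⁿ; fromEquivalence)

bit : Bool → ℕ
bit x = if x then 1 else 0

module _ {V : Set} where

  UP-trans : ∀ {F F′ : CNF V} {α α′ : List (Lit V)} {l} →
             (∀ {C} → C ∈ F → C ∈ F′) → (∀ {l′} → l′ ∈ α′ → UP F′ , α ⊢ l′) →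
             UP F , α′ ⊢ l → UP F′ , α ⊢ l
  UP-trans F⊆F′ α′-derived (given l∈α′)      = α′-derived l∈α′
  UP-trans F⊆F′ α′-derived (unit C∈F l∈C ¬C) =
    unit (F⊆F′ C∈F) l∈C (λ l′ l′∈C l′≢l → UP-trans F⊆F′ α′-derived (¬C l′ l′∈C l′≢l))
  UP-trans F⊆F′ α′-derived (conflict l′ p q) =
    conflict l′ (UP-trans F⊆F′ α′-derived p) (UP-trans F⊆F′ α′-derived q)

  propagate : ∀ {F : CNF V} {α} pre {l} post → (pre ++ l ∷ post) ∈ F →
              All (λ l′ → UP F , α ⊢ negate l′) pre →
              All (λ l′ → UP F , α ⊢ negate l′) post →
              UP F , α ⊢ l
  propagate {F} {α} pre {l} post C∈F ⊢pre ⊢post = unit C∈F (∈-++⁺ʳ pre (here refl)) others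
    where
    others : ∀ l′ → l′ ∈ pre ++ l ∷ post → l′ ≢ l → UP F , α ⊢ negate l′
    others l′ l′∈C l′≢l with ∈-++⁻ pre l′∈C
    ... | inj₁ l′∈pre          = All.lookup ⊢pre l′∈pre
    ... | inj₂ (here refl)     = ⊥-elim (l′≢l refl)
    ... | inj₂ (there l′∈post) = All.lookup ⊢post l′∈post

  varOf-negate : ∀ (l : Lit V) → varOf (negate l) ≡ varOf l
  varOf-negate (pos x) = refl
  varOf-negate (neg x) = refl

  evalLit-negate : ∀ σ (l : Lit V) → evalLit σ (negate l) ≡ not (evalLit σ l)
  evalLit-negate σ (pos x) = refl
  evalLit-negate σ (neg x) = sym (not-involutive (σ x))

module _ {V : Set} (σ : V → Bool) where

  countTrue-sum : ∀ (L : List (Lit V)) → countTrue σ L ≡ sum (map (λ l → bit (evalLit σ l)) L)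
  countTrue-sum []      = refl
  countTrue-sum (l ∷ L) = cong (bit (evalLit σ l) +_) (countTrue-sum L)

  countTrue-++ : ∀ (L L′ : List (Lit V)) → countTrue σ (L ++ L′) ≡ countTrue σ L + countTrue σ L′
  countTrue-++ []      L′ = refl
  countTrue-++ (l ∷ L) L′ =
    trans (cong (bit (evalLit σ l) +_) (countTrue-++ L L′)) (sym (+-assoc (bit (evalLit σ l)) _ _))

  countTrue≤length : ∀ (L : List (Lit V)) → countTrue σ L ≤ length L
  countTrue≤length []      = z≤n
  countTrue≤length (l ∷ L) with evalLit σ l
  ... | true  = s≤s (countTrue≤length L)
  ... | false = m≤n⇒m≤1+n (countTrue≤length L)

module _ {V : Set} (τ σ : V → Bool) where

  countTrue-mono : ∀ L → (∀ {l} → l ∈ L → τ ⊨ˡ l → σ ⊨ˡ l) →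
                   countTrue τ L ≤ countTrue σ L
  countTrue-mono []      τ⇒σ = z≤n
  countTrue-mono (x ∷ L) τ⇒σ with evalLit τ x in τx
  ... | true  rewrite τ⇒σ (here refl) τx = s≤s (countTrue-mono L (λ l∈ → τ⇒σ (there l∈)))
  ... | false = ≤-trans (countTrue-mono L (λ l∈ → τ⇒σ (there l∈))) (m≤n+m _ _)

  countTrue-tight : ∀ L → (∀ {l} → l ∈ L → τ ⊨ˡ l → σ ⊨ˡ l) →
                    countTrue σ L ≤ countTrue τ L →
                    ∀ {l} → l ∈ L → evalLit τ l ≡ false → evalLit σ l ≡ false
  countTrue-tight (x ∷ L) τ⇒σ σ≤τ l∈ τl with evalLit τ x in τx | evalLit σ x in σx | l∈
  ... | true  | false | _ = ⊥-elim (not-¬ (τ⇒σ (here refl) τx) σx)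
  ... | false | true  | _ = ⊥-elim (<⇒≱ σ≤τ (countTrue-mono L (λ l∈ → τ⇒σ (there l∈))))
  ... | true  | true  | here refl  = ⊥-elim (not-¬ τx τl)
  ... | false | false | here refl  = σx
  ... | true  | true  | there l∈L = countTrue-tight L (λ l∈ → τ⇒σ (there l∈)) (≤-pred σ≤τ) l∈L τl
  ... | false | false | there l∈L = countTrue-tight L (λ l∈ → τ⇒σ (there l∈)) σ≤τ l∈L τl

module _ {A : Set} where

  length-as-sum : ∀ (xs : List A) → length xs ≡ sum (map (λ _ → 1) xs)
  length-as-sum []       = refl
  length-as-sum (x ∷ xs) = cong suc (length-as-sum xs)

  sum-map-cong : ∀ {f g : A → ℕ} xs → (∀ x → f x ≡ g x) → sum (map f xs) ≡ sum (map g xs)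
  sum-map-cong xs f≗g = cong sum (map-cong f≗g xs)

  sum-map-zero : ∀ (xs : List A) → sum (map (λ _ → 0) xs) ≡ 0
  sum-map-zero []       = refl
  sum-map-zero (x ∷ xs) = sum-map-zero xs

  sum-map-+ : ∀ (f g : A → ℕ) xs →
              sum (map (λ x → f x + g x) xs) ≡ sum (map f xs) + sum (map g xs)
  sum-map-+ f g []       = refl
  sum-map-+ f g (x ∷ xs) = begin
    (f x + g x) + sum (map (λ x → f x + g x) xs)     ≡⟨ cong ((f x + g x) +_) (sum-map-+ f g xs) ⟩
    (f x + g x) + (sum (map f xs) + sum (map g xs))  ≡⟨ interchange (f x) (g x) _ _ ⟩
    (f x + sum (map f xs)) + (g x + sum (map g xs))  ∎
    where open ≡-Reasoning

  *-distribˡ-sum-map : ∀ c (f : A → ℕ) xs → c * sum (map f xs) ≡ sum (map (λ x → c * f x) xs)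
  *-distribˡ-sum-map c f []       = *-zeroʳ c
  *-distribˡ-sum-map c f (x ∷ xs) =
    trans (*-distribˡ-+ c (f x) _) (cong (c * f x +_) (*-distribˡ-sum-map c f xs))

  *-distribʳ-sum-map : ∀ c (f : A → ℕ) xs → sum (map f xs) * c ≡ sum (map (λ x → f x * c) xs)
  *-distribʳ-sum-map c f []       = refl
  *-distribʳ-sum-map c f (x ∷ xs) =
    trans (*-distribʳ-+ c (f x) _) (cong (f x * c +_) (*-distribʳ-sum-map c f xs))

  sum-map-replicate : ∀ (f : A → ℕ) k x → sum (map f (replicate k x)) ≡ k * f x
  sum-map-replicate f zero    x = refl
  sum-map-replicate f (suc k) x = cong (f x +_) (sum-map-replicate f k x)

sum-map-comm : ∀ {A B : Set} (g : A → B → ℕ) xs ys →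
               sum (map (λ x → sum (map (g x) ys)) xs) ≡
               sum (map (λ y → sum (map (λ x → g x y) xs)) ys)
sum-map-comm g []       ys = sym (sum-map-zero ys)
sum-map-comm g (x ∷ xs) ys =
  trans (cong (sum (map (g x) ys) +_) (sum-map-comm g xs ys))
        (sym (sum-map-+ (g x) (λ y → sum (map (λ x → g x y) xs)) ys))

sumTo-suc : ∀ m f → sumTo (suc m) f ≡ sumTo m f + f (suc m)
sumTo-suc m f = begin
  sumTo (suc m) f                            ≡⟨ cong (λ js → sum (map f js)) (sym (upTo-∷ʳ (suc m))) ⟩
  sum (map f (upTo (suc m) ++ suc m ∷ []))   ≡⟨ cong sum (map-++ f (upTo (suc m)) _) ⟩
  sum (map f (upTo (suc m)) ++ f (suc m) ∷ []) ≡⟨ sum-++ (map f (upTo (suc m))) _ ⟩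
  sumTo m f + (f (suc m) + 0)                ≡⟨ cong (sumTo m f +_) (+-identityʳ _) ⟩
  sumTo m f + f (suc m)                      ∎
  where open ≡-Reasoning

sum-map-concatMap : ∀ {A B : Set} (f : B → ℕ) (g : A → List B) xs →
                    sum (map f (concatMap g xs)) ≡ sum (map (λ x → sum (map f (g x))) xs)
sum-map-concatMap f g []       = refl
sum-map-concatMap f g (x ∷ xs) = begin
  sum (map f (g x ++ concatMap g xs))            ≡⟨ cong sum (map-++ f (g x) (concatMap g xs)) ⟩
  sum (map f (g x) ++ map f (concatMap g xs))    ≡⟨ sum-++ (map f (g x)) _ ⟩
  sum (map f (g x)) + sum (map f (concatMap g xs))
    ≡⟨ cong (sum (map f (g x)) +_) (sum-map-concatMap f g xs) ⟩
  sum (map f (g x)) + sum (map (λ x → sum (map f (g x))) xs) ∎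
  where open ≡-Reasoning

≤ᵇ≡true⇒≤ : ∀ {m n} → (m ≤ᵇ n) ≡ true → m ≤ n
≤ᵇ≡true⇒≤ {m} {n} eq = ≤ᵇ⇒≤ m n (Equivalence.from T-≡ eq)

≰⇒≤ᵇ≡false : ∀ {m n} → ¬ m ≤ n → (m ≤ᵇ n) ≡ false
≰⇒≤ᵇ≡false {m} {n} m≰n = det (≤ᵇ-reflects-≤ m n) (ofⁿ m≰n)

≤ᵇ-cong-⇔ : ∀ {m n m′ n′} → (m ≤ n → m′ ≤ n′) → (m′ ≤ n′ → m ≤ n) → (m ≤ᵇ n) ≡ (m′ ≤ᵇ n′)
≤ᵇ-cong-⇔ {m} {n} {m′} {n′} to from =
  det (≤ᵇ-reflects-≤ m n) (fromEquivalence (from ∘ ≤ᵇ⇒≤ m′ n′) (≤⇒≤ᵇ ∘ to))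

∈-range1⁺ : ∀ {k K} → 1 ≤ k → k ≤ K → k ∈ range1 K
∈-range1⁺ {suc k} (s≤s _) k≤K = ∈-map⁺ suc (∈-upTo⁺ k≤K)

∈-range1⁻ : ∀ {k K} → k ∈ range1 K → 1 ≤ k × k ≤ K
∈-range1⁻ k∈ with ∈-map⁻ suc k∈
... | k , k∈upTo , refl = s≤s z≤n , ∈-upTo⁻ k∈upTo

length-range1 : ∀ K → length (range1 K) ≡ K
length-range1 K = trans (length-map suc (upTo K)) (length-upTo K)

sum-map-range1-suc : ∀ (f : ℕ → ℕ) K →
                     sum (map f (range1 (suc K))) ≡ f 1 + sum (map (f ∘ suc) (range1 K))
sum-map-range1-suc f K = cong (λ ks → f 1 + sum ks) (begin
  map f (map suc (applyUpTo suc K)) ≡⟨ cong (map f ∘ map suc) (sym (map-upTo suc K)) ⟩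
  map f (map suc (range1 K))        ≡⟨ sym (map-∘ (range1 K)) ⟩
  map (f ∘ suc) (range1 K)          ∎)
  where open ≡-Reasoning

count-range1-≤ᵇ : ∀ K q → sum (map (λ k → bit (k ≤ᵇ q)) (range1 K)) ≡ K ⊓ q
count-range1-≤ᵇ zero    q       = refl
count-range1-≤ᵇ (suc K) zero    =
  trans (sum-map-range1-suc (λ k → bit (k ≤ᵇ 0)) K) (sum-map-zero (range1 K))
count-range1-≤ᵇ (suc K) (suc q) = trans (sum-map-range1-suc (λ k → bit (k ≤ᵇ suc q)) K)
  (cong suc (trans (sum-map-cong (range1 K) (λ k → cong bit (≤ᵇ-cong-⇔ {suc k} {suc q} s≤s⁻¹ s≤s)))
                   (count-range1-≤ᵇ K q)))

∈-replicate⁺ : ∀ {A : Set} {x : A} k → k ≢ 0 → x ∈ replicate k x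
∈-replicate⁺ zero    k≢0 = ⊥-elim (k≢0 refl)
∈-replicate⁺ (suc k) _   = here refl

∈-replicate⁻ : ∀ {A : Set} {x y : A} k → y ∈ replicate k x → y ≡ x
∈-replicate⁻ (suc k) (here y≡x) = y≡x
∈-replicate⁻ (suc k) (there y∈) = ∈-replicate⁻ k y∈

downward-induction : ∀ (P : ℕ → Set) m → (∀ j → j ≤ m → (∀ k → j < k → k ≤ m → P k) → P j) →
                     ∀ j → j ≤ m → P j
downward-induction P m step j j≤m = from m j (m≤m+n m j) j ≤-refl j≤m
  where
  from : ∀ t i → m ≤ t + i → ∀ k → i ≤ k → k ≤ m → P k
  from zero    i m≤i   k i≤k k≤m = step k k≤m λ k′ k<k′ k′≤m →
    ⊥-elim (<⇒≱ k<k′ (≤-trans k′≤m (≤-trans m≤i i≤k)))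
  from (suc t) i m≤t+i k i≤k k≤m = step k k≤m λ k′ k<k′ k′≤m →
    from t (suc i) (subst (m ≤_) (sym (+-suc t i)) m≤t+i) k′ (≤-trans (s≤s i≤k) k<k′) k′≤m

-- Base-b carries

module _ (b : ℕ) {{_ : NonZero b}} where

  -- carry c j is column j of the schoolbook addition of Σ_j b^j c_j, incoming carry included.
  carry : (ℕ → ℕ) → ℕ → ℕ
  carry c zero    = c 0
  carry c (suc j) = carry c j / b + c (suc j)

  *≤⇒≤/ : ∀ {l t} → b * l ≤ t → l ≤ t / b
  *≤⇒≤/ {l} {t} bl≤t = subst (_≤ t / b) (m*n/n≡m l b) (/-monoˡ-≤ b (subst (_≤ t) (*-comm b l) bl≤t))

  ≤/⇒*≤ : ∀ {l t} → l ≤ t / b → b * l ≤ t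
  ≤/⇒*≤ {l} {t} l≤t/b = ≤-trans (subst (_≤ t / b * b) (*-comm l b) (*-monoˡ-≤ b l≤t/b)) (m/n*n≤m t b)

  *-split-digit : ∀ p x → p * x ≡ p * (x % b) + b * p * (x / b)
  *-split-digit p x = begin
    p * x                         ≡⟨ cong (p *_) (m≡m%n+[m/n]*n x b) ⟩
    p * (x % b + x / b * b)       ≡⟨ distrib p (x % b) (x / b) b ⟩
    p * (x % b) + b * p * (x / b) ∎
    where
    open ≡-Reasoning
    distrib : ∀ p r q b → p * (r + q * b) ≡ p * r + b * p * q
    distrib = solve-∀

  carry-expansion : ∀ c m → sumTo m (λ j → b ^ j * c j) ≡
                    sumTo m (λ j → b ^ j * (carry c j % b)) + b ^ suc m * (carry c m / b)
  carry-expansion c zero = begin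
    1 * c 0 + 0                                   ≡⟨ +-identityʳ _ ⟩
    1 * c 0                                       ≡⟨ *-split-digit 1 (c 0) ⟩
    1 * (c 0 % b) + b * 1 * (c 0 / b)             ≡⟨ cong (_+ b * 1 * (c 0 / b)) (sym (+-identityʳ _)) ⟩
    (1 * (c 0 % b) + 0) + b * 1 * (c 0 / b)       ∎
    where open ≡-Reasoning
  carry-expansion c (suc m) = begin
    sumTo (suc m) (λ j → b ^ j * c j)              ≡⟨ sumTo-suc m (λ j → b ^ j * c j) ⟩
    sumTo m (λ j → b ^ j * c j) + p * c (suc m)    ≡⟨ cong (_+ p * c (suc m)) (carry-expansion c m) ⟩
    (D + p * (carry c m / b)) + p * c (suc m)      ≡⟨ +-assoc D _ _ ⟩
    D + (p * (carry c m / b) + p * c (suc m))      ≡⟨ cong (D +_) (sym (*-distribˡ-+ p _ _)) ⟩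
    D + p * x                                      ≡⟨ cong (D +_) (*-split-digit p x) ⟩
    D + (p * (x % b) + b * p * (x / b))            ≡⟨ sym (+-assoc D _ _) ⟩
    (D + p * (x % b)) + b * p * (x / b)
      ≡⟨ cong (_+ b * p * (x / b)) (sym (sumTo-suc m (λ j → b ^ j * (carry c j % b)))) ⟩
    sumTo (suc m) (λ j → b ^ j * (carry c j % b)) + b * p * (x / b) ∎
    where
    open ≡-Reasoning
    p = b ^ suc m
    x = carry c (suc m)
    D = sumTo m (λ j → b ^ j * (carry c j % b))

  digit-unique : ∀ {x y r r′} → x < b → y < b → x + b * r ≡ y + b * r′ → x ≡ y × r ≡ r′
  digit-unique {x} {y} {r} {r′} x<b y<b eq =
    x≡y , *-cancelˡ-≡ r r′ b (+-cancelˡ-≡ x _ _ (trans eq (cong (_+ b * r′) (sym x≡y))))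
    where
    low-digit : ∀ {z} q → z < b → (z + b * q) % b ≡ z
    low-digit {z} q z<b =
      trans (cong (λ t → (z + t) % b) (*-comm b q)) (trans ([m+kn]%n≡m%n z q b) (m<n⇒m%n≡m z<b))
    x≡y : x ≡ y
    x≡y = trans (sym (low-digit r x<b)) (trans (cong (_% b) eq) (low-digit r′ y<b))

  digits-unique : ∀ m (x y : ℕ → ℕ) r r′ → (∀ j → j ≤ m → x j < b) → (∀ j → j ≤ m → y j < b) →
                  sumTo m (λ j → b ^ j * x j) + b ^ suc m * r ≡
                  sumTo m (λ j → b ^ j * y j) + b ^ suc m * r′ →
                  (∀ j → j ≤ m → x j ≡ y j) × r ≡ r′
  digits-unique zero x y r r′ x<b y<b eq with
    digit-unique (x<b 0 z≤n) (y<b 0 z≤n) (trans (sym (lowest x r)) (trans eq (lowest y r′)))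
    where
    lowest : ∀ (z : ℕ → ℕ) q → sumTo 0 (λ j → b ^ j * z j) + b ^ 1 * q ≡ z 0 + b * q
    lowest z q = normalise (z 0) q b
      where
      normalise : ∀ z q b → (1 * z + 0) + b * 1 * q ≡ z + b * q
      normalise = solve-∀
  ... | x0≡y0 , r≡r′ = (λ { zero _ → x0≡y0 }) , r≡r′
  digits-unique (suc m) x y r r′ x<b y<b eq with
    digits-unique m x y (x (suc m) + b * r) (y (suc m) + b * r′)
      (λ j j≤m → x<b j (m≤n⇒m≤1+n j≤m)) (λ j j≤m → y<b j (m≤n⇒m≤1+n j≤m))
      (trans (sym (shift-top x r)) (trans eq (shift-top y r′)))
    where
    shift-top : ∀ (z : ℕ → ℕ) q → sumTo (suc m) (λ j → b ^ j * z j) + b ^ suc (suc m) * q ≡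
                                  sumTo m (λ j → b ^ j * z j) + b ^ suc m * (z (suc m) + b * q)
    shift-top z q = trans (cong (_+ b ^ suc (suc m) * q) (sumTo-suc m (λ j → b ^ j * z j)))
                          (regroup (sumTo m (λ j → b ^ j * z j)) (b ^ suc m) (z (suc m)) q b)
      where
      regroup : ∀ D p t q b → D + p * t + b * p * q ≡ D + p * (t + b * q)
      regroup = solve-∀
  ... | lower≡ , top≡ with digit-unique (x<b (suc m) ≤-refl) (y<b (suc m) ≤-refl) top≡
  ... | xtop≡ytop , r≡r′ = all≡ , r≡r′
    where
    all≡ : ∀ j → j ≤ suc m → x j ≡ y j
    all≡ j j≤ with m≤n⇒m<n∨m≡n j≤
    ... | inj₁ j<  = lower≡ j (≤-pred j<)
    ... | inj₂ refl = xtop≡ytop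

  carry-digits : ∀ m c ε → (∀ j → j ≤ m → ε j < b) →
                 sumTo m (λ j → b ^ j * c j) ≡ sumTo m (λ j → b ^ j * ε j) →
                 ∀ j → j ≤ m → carry c j % b ≡ ε j
  carry-digits m c ε ε<b eq = proj₁ (digits-unique m (λ j → carry c j % b) ε (carry c m / b) 0
    (λ j _ → m%n<n (carry c j) b) ε<b
    (trans (sym (carry-expansion c m)) (trans eq (sym no-overflow))))
    where
    no-overflow : sumTo m (λ j → b ^ j * ε j) + b ^ suc m * 0 ≡ sumTo m (λ j → b ^ j * ε j)
    no-overflow = trans (cong (sumTo m (λ j → b ^ j * ε j) +_) (*-zeroʳ (b ^ suc m))) (+-identityʳ _)

  carry-top< : ∀ m c → sumTo m (λ j → b ^ j * c j) < b ^ suc m → carry c m < b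
  carry-top< m c bound = m/n≡0⇒m<n quotient≡0
    where
    quotient≡0 : carry c m / b ≡ 0
    quotient≡0 with carry c m / b | carry-expansion c m
    ... | zero  | _         = refl
    ... | suc k | expansion = ⊥-elim (<⇒≱ bound (begin
      b ^ suc m            ≤⟨ m≤m*n (b ^ suc m) (suc k) ⟩
      b ^ suc m * suc k    ≤⟨ m≤n+m _ _ ⟩
      _ + b ^ suc m * suc k ≡⟨ sym expansion ⟩
      sumTo m (λ j → b ^ j * c j) ∎))
      where open ≤-Reasoning

-- The SN-Opt encoding

colSum : (n : ℕ) → (Fin n → ℕ → ℕ) → (Fin n → ℕ) → ℕ → ℕ
colSum n A w j = sumFin n (λ i → A i j * w i)

module _ (n : ℕ) (A : Fin n → ℕ → ℕ) (w : Fin n → ℕ) where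

  sumFin-column : ∀ c j → sumFin n (λ i → c * A i j * w i) ≡ c * colSum n A w j
  sumFin-column c j = trans (sum-map-cong (allFin n) (λ i → *-assoc c (A i j) (w i)))
                            (sym (*-distribˡ-sum-map c (λ i → A i j * w i) (allFin n)))

  sumFin-expand : ∀ b m (a : Fin n → ℕ) → (∀ i → a i ≡ sumTo m (λ j → b ^ j * A i j)) →
                  sumFin n (λ i → a i * w i) ≡ sumTo m (λ j → b ^ j * colSum n A w j)
  sumFin-expand b m a a≡ = begin
    sumFin n (λ i → a i * w i)
      ≡⟨ sum-map-cong (allFin n) (λ i → trans (cong (_* w i) (a≡ i))
                                   (*-distribʳ-sum-map (w i) (λ j → b ^ j * A i j) (upTo (suc m)))) ⟩
    sumFin n (λ i → sumTo m (λ j → b ^ j * A i j * w i))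
      ≡⟨ sum-map-comm (λ i j → b ^ j * A i j * w i) (allFin n) (upTo (suc m)) ⟩
    sumTo m (λ j → sumFin n (λ i → b ^ j * A i j * w i))
      ≡⟨ sum-map-cong (upTo (suc m)) (λ j → sumFin-column (b ^ j) j) ⟩
    sumTo m (λ j → b ^ j * colSum n A w j) ∎
    where open ≡-Reasoning

module Propagation (n b m : ℕ) {{_ : NonZero b}} (d : Fin n → ℕ) (A : Fin n → ℕ → ℕ) (ε : ℕ → ℕ)
                   (W : Set) (nets : ℕ → CNF (Var n W)) (v : Fin n → ℕ) (v≤d : ∀ i → v i ≤ d i) where

  open SNOpt n b m d A ε W

  s : ℕ → ℕ
  s = carry b (colSum n A v)

  -- The total assignment extending v that unit propagation reproduces on the networks.
  τ : V → Bool
  τ (xv i k) = k ≤ᵇ v i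
  τ (yv j l) = l ≤ᵇ s j
  τ _        = false

  nextMultiple : ℕ → ℕ
  nextMultiple j = b * suc (s j / b)

  ys : ℕ → List L
  ys j = map (λ l → pos (yv j (b * l))) (range1 (e j / b))

  sum-map-Xs : ∀ (ω : L → ℕ) j →
               sum (map ω (Xs j)) ≡
               sumFin n (λ i → A i j * sum (map (λ k → ω (pos (xv i k))) (range1 (d i))))
  sum-map-Xs ω j = trans (sum-map-concatMap ω (λ i → X i j) (allFin n)) (sum-map-cong (allFin n) λ i →
    trans (sum-map-concatMap ω (λ k → replicate (A i j) (pos (xv i k))) (range1 (d i)))
          (trans (sum-map-cong (range1 (d i)) (λ k → sum-map-replicate ω (A i j) (pos (xv i k))))
                 (sym (*-distribˡ-sum-map (A i j) (λ k → ω (pos (xv i k))) (range1 (d i))))))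

  countTrue-Xs : ∀ j → countTrue τ (Xs j) ≡ colSum n A v j
  countTrue-Xs j = trans (countTrue-sum τ (Xs j)) (trans (sum-map-Xs (λ l → bit (evalLit τ l)) j)
    (sum-map-cong (allFin n) λ i →
      cong (A i j *_) (trans (count-range1-≤ᵇ (d i) (v i)) (m≥n⇒m⊓n≡n (v≤d i)))))

  length-Xs : ∀ j → length (Xs j) ≡ colSum n A d j
  length-Xs j = trans (length-as-sum (Xs j)) (trans (sum-map-Xs (λ _ → 1) j)
    (sum-map-cong (allFin n) λ i →
      cong (A i j *_) (trans (sym (length-as-sum (range1 (d i)))) (length-range1 (d i)))))

  countTrue-inputs : ∀ j → countTrue τ (inputs j) ≡ s j
  s≤e : ∀ j → s j ≤ e j
  s≤e j = subst (_≤ e j) (countTrue-inputs j) (countTrue≤length τ (inputs j))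

  countTrue-inputs zero    = countTrue-Xs 0
  countTrue-inputs (suc j) = begin
    countTrue τ (ys j ++ Xs (suc j))               ≡⟨ countTrue-++ τ (ys j) (Xs (suc j)) ⟩
    countTrue τ (ys j) + countTrue τ (Xs (suc j))  ≡⟨ cong₂ _+_ countTrue-ys (countTrue-Xs (suc j)) ⟩
    s j / b + colSum n A v (suc j)                 ∎
    where
    open ≡-Reasoning
    countTrue-ys : countTrue τ (ys j) ≡ s j / b
    countTrue-ys = begin
      countTrue τ (ys j)                                    ≡⟨ countTrue-sum τ (ys j) ⟩
      sum (map (λ l → bit (evalLit τ l)) (ys j))            ≡⟨ cong sum (sym (map-∘ (range1 (e j / b)))) ⟩
      sum (map (λ l → bit (b * l ≤ᵇ s j)) (range1 (e j / b)))
        ≡⟨ sum-map-cong (range1 (e j / b)) (λ l → cong bit (≤ᵇ-cong-⇔ (*≤⇒≤/ b) (≤/⇒*≤ b))) ⟩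
      sum (map (λ l → bit (l ≤ᵇ s j / b)) (range1 (e j / b))) ≡⟨ count-range1-≤ᵇ (e j / b) (s j / b) ⟩
      (e j / b) ⊓ (s j / b)                                 ≡⟨ m≥n⇒m⊓n≡n (/-monoˡ-≤ b (s≤e j)) ⟩
      s j / b                                               ∎

  e≡carry : ∀ j → e j ≡ carry b (colSum n A d) j
  e≡carry zero    = length-Xs 0
  e≡carry (suc j) = trans (length-++ (ys j)) (cong₂ _+_ length-ys (length-Xs (suc j)))
    where
    length-ys : length (ys j) ≡ carry b (colSum n A d) j / b
    length-ys = trans (length-map _ (range1 (e j / b)))
                      (trans (length-range1 (e j / b)) (cong (_/ b) (e≡carry j)))

  τ⊨? : ∀ l → Dec (τ ⊨ˡ l)
  τ⊨? l = evalLit τ l Bool.≟ true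

  trueInputs : ℕ → List L
  trueInputs j = filter τ⊨? (inputs j)

  ∈-trueInputs⁻ : ∀ j {l} → l ∈ trueInputs j → l ∈ inputs j × τ ⊨ˡ l
  ∈-trueInputs⁻ j = ∈-filter⁻ τ⊨? {xs = inputs j}

  input-in-scope : ∀ {j l} → l ∈ inputs j → InScope j (varOf l)
  input-in-scope l∈ = inj₁ (Any.map (λ { refl → refl }) l∈)

  trueInputs-in-scope : ∀ j → All (λ l → InScope j (varOf l)) (trueInputs j)
  trueInputs-in-scope j = All.tabulate (λ l∈ → input-in-scope (proj₁ (∈-trueInputs⁻ j l∈)))

  trueInputs-extends : ∀ j {σ} → σ ⊨ᵃ trueInputs j → ∀ {l} → l ∈ inputs j → τ ⊨ˡ l → σ ⊨ˡ l
  trueInputs-extends j σ⊨ l∈ τ⊨l = All.lookup σ⊨ (∈-filter⁺ τ⊨? l∈ τ⊨l)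

  ∈-Xs⁻ : ∀ {j l} → l ∈ Xs j → Σ (Fin n) λ i → Σ ℕ λ k → 1 ≤ k × l ≡ pos (xv i k)
  ∈-Xs⁻ {j} l∈ with ∈-concat⁻′ (map (λ i → X i j) (allFin n)) l∈
  ... | _ , l∈X , X∈ with ∈-map⁻ (λ i → X i j) X∈
  ... | i , _ , refl with ∈-concat⁻′ (map (λ k → replicate (A i j) (pos (xv i k))) (range1 (d i))) l∈X
  ... | _ , l∈rep , rep∈ with ∈-map⁻ (λ k → replicate (A i j) (pos (xv i k))) rep∈
  ... | k , k∈ , refl = i , k , proj₁ (∈-range1⁻ k∈) , ∈-replicate⁻ (A i j) l∈rep

  Xs⊆inputs : ∀ j {l} → l ∈ Xs j → l ∈ inputs j
  Xs⊆inputs zero    l∈ = l∈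
  Xs⊆inputs (suc j) l∈ = ∈-++⁺ʳ (ys j) l∈

  negated-input-in-scope : ∀ {j l} → l ∈ inputs j → InScope j (varOf (negate l))
  negated-input-in-scope {l = l} l∈ = subst (InScope _) (sym (varOf-negate l)) (input-in-scope l∈)

  at-most-s⊨false-inputs : ∀ j {σ} → σ ⊨ᵃ trueInputs j → countTrue σ (inputs j) ≤ s j →
                           ∀ {l} → l ∈ inputs j → evalLit τ l ≡ false → σ ⊨ˡ negate l
  at-most-s⊨false-inputs j {σ} σ⊨ count≤s {l} l∈ τl = trans (evalLit-negate σ l) (cong not
    (countTrue-tight τ σ (inputs j) (trueInputs-extends j σ⊨)
      (subst (countTrue σ (inputs j) ≤_) (sym (countTrue-inputs j)) count≤s) l∈ τl))

  output-false⇒count< : ∀ j {σ l} → SortRel j σ → 1 ≤ l → l ≤ e j → σ ⊨ˡ neg (yv j l) →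
                        countTrue σ (inputs j) < l
  output-false⇒count< j {σ} {l} sorted 1≤l l≤e σ⊨¬y = ≰⇒> λ l≤count →
    contradiction (subst (λ x → not x ≡ true) (Equivalence.from (sorted l 1≤l l≤e) l≤count) σ⊨¬y) λ ()

  module Derivations (isSN : ∀ j → j ≤ m → IsSN j (nets j)) (ε<b : ∀ j → j ≤ m → ε j < b)
           (s-digits : ∀ j → j ≤ m → s j % b ≡ ε j) (carry-d-top : carry b (colSum n A d) m < b) where

    ⊢_ : L → Set
    ⊢ l = UP snOpt nets , assignA v ⊢ l

    -- y_j^l with l > e_j is the constant false, hence refuted for free.
    Refuted : ℕ → ℕ → Set
    Refuted j l = l ≤ e j → ⊢ neg (yv j l)

    net⊆snOpt : ∀ {j C} → j ≤ m → C ∈ nets j → C ∈ snOpt nets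
    net⊆snOpt {j} j≤m C∈ =
      ∈-++⁺ʳ orderClauses (∈-++⁺ˡ (∈-concat⁺′ C∈ (∈-map⁺ nets (∈-upTo⁺ (s≤s j≤m)))))

    oClauses⊆snOpt : ∀ {j k C} → j ≤ m → 1 ≤ k → k < b → C ∈ oClauses j k → C ∈ snOpt nets
    oClauses⊆snOpt {j} j≤m 1≤k k<b C∈ =
      ∈-++⁺ʳ orderClauses (∈-++⁺ʳ (concatMap nets (upTo (suc m))) (∈-++⁺ˡ
        (∈-concat⁺′ (∈-concat⁺′ C∈ (∈-map⁺ (oClauses j) (∈-range1⁺ 1≤k (∸-monoˡ-≤ 1 k<b))))
                    (∈-map⁺ (λ j → concatMap (oClauses j) (range1 (b ∸ 1))) (∈-upTo⁺ (s≤s j≤m))))))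

    finalClause∈snOpt : ∀ {j} → j ≤ m → suc (ε j) < b → finalClause j ∈ snOpt nets
    finalClause∈snOpt j≤m εj+1<b =
      ∈-++⁺ʳ orderClauses (∈-++⁺ʳ (concatMap nets (upTo (suc m))) (∈-++⁺ʳ tseytinClauses
        (∈-map⁺ finalClause (∈-filter⁺ (λ j → T? (suc (ε j) <ᵇ b)) (∈-upTo⁺ (s≤s j≤m)) (<⇒<ᵇ εj+1<b)))))

    ∈-idx : ∀ j {k l} → 1 ≤ l → l ≤ e j → l % b ≡ k % b → l ∈ idx j k
    ∈-idx j {k} 1≤l l≤e l≡k =
      ∈-filter⁺ (λ l → T? ((l % b) ≡ᵇ (k % b))) (∈-range1⁺ 1≤l l≤e) (≡⇒≡ᵇ _ _ l≡k)

    module Tseytin {j k l} (j≤m : j ≤ m) (1≤k : 1 ≤ k) (k<b : k < b) (l∈idx : l ∈ idx j k) where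

      conj⊆snOpt : ∀ {C} → C ∈ conjClauses j k l → C ∈ snOpt nets
      conj⊆snOpt C∈ =
        oClauses⊆snOpt j≤m 1≤k k<b (∈-++⁺ˡ (∈-concat⁺′ C∈ (∈-map⁺ (conjClauses j k) l∈idx)))

      or∈snOpt : (pos (ov j k) ∷ neg (tv j l) ∷ []) ∈ snOpt nets
      or∈snOpt = oClauses⊆snOpt j≤m 1≤k k<b (∈-++⁺ʳ (concatMap (conjClauses j k) (idx j k))
        (there (∈-map⁺ (λ l → pos (ov j k) ∷ neg (tv j l) ∷ []) l∈idx)))

      conj-shape : (l + b ∸ k ≤ e j ×
                    (pos (tv j l) ∷ neg (yv j l) ∷ pos (yv j (l + b ∸ k)) ∷ []) ∈ conjClauses j k l)
                 ⊎ (pos (tv j l) ∷ neg (yv j l) ∷ []) ∈ conjClauses j k l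
      conj-shape with (l + b ∸ k) ≤ᵇ e j in inRange
      ... | true  = inj₁ (≤ᵇ≡true⇒≤ inRange , there (there (here refl)))
      ... | false = inj₂ (there (here refl))

      t-true : ⊢ pos (yv j l) → Refuted j (l + b ∸ k) → ⊢ pos (tv j l)
      t-true ⊢y refuted with conj-shape
      ... | inj₁ (inRange , C∈) = propagate [] _ (conj⊆snOpt C∈) [] (⊢y ∷ refuted inRange ∷ [])
      ... | inj₂ C∈             = propagate [] _ (conj⊆snOpt C∈) [] (⊢y ∷ [])

      y-false : ⊢ neg (tv j l) → Refuted j (l + b ∸ k) → ⊢ neg (yv j l)
      y-false ⊢¬t refuted with conj-shape
      ... | inj₁ (inRange , C∈) =
        propagate (pos (tv j l) ∷ []) _ (conj⊆snOpt C∈) (⊢¬t ∷ []) (refuted inRange ∷ [])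
      ... | inj₂ C∈             = propagate (pos (tv j l) ∷ []) [] (conj⊆snOpt C∈) (⊢¬t ∷ []) []

      o-true : ⊢ pos (tv j l) → ⊢ pos (ov j k)
      o-true ⊢t = propagate [] _ or∈snOpt [] (⊢t ∷ [])

      t-false : ⊢ neg (ov j k) → ⊢ neg (tv j l)
      t-false ⊢¬o = propagate (pos (ov j k) ∷ []) [] or∈snOpt (⊢¬o ∷ []) []

    via-network : ∀ {j} → j ≤ m → (α : List L) → All (λ l → InScope j (varOf l)) α →
                  (∀ {l} → l ∈ α → ⊢ l) → ∀ l → InScope j (varOf l) →
                  (∀ σ → σ ⊨ᵃ α → SortRel j σ → σ ⊨ˡ l) → ⊢ l
    via-network {j} j≤m α α-in-scope ⊢α l l-in-scope α⊨l =
      UP-trans (net⊆snOpt j≤m) ⊢α (IsSN.domCons (isSN j j≤m) α α-in-scope l l-in-scope α⊨l)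

    true-x-given : ∀ {j l} → l ∈ Xs j → τ ⊨ˡ l → ⊢ l
    true-x-given l∈ τ⊨l with ∈-Xs⁻ l∈
    ... | i , k , 1≤k , refl =
      given (∈-concat⁺′ (∈-map⁺ (λ k → pos (xv i k)) (∈-range1⁺ 1≤k (≤ᵇ≡true⇒≤ τ⊨l)))
                        (∈-map⁺ (λ i → map (λ k → pos (xv i k)) (range1 (v i))) (∈-allFin i)))

    true-input-derived : ∀ j → j ≤ m → ∀ {l} → l ∈ trueInputs j → ⊢ l
    y-true : ∀ j → j ≤ m → ∀ {l} → 1 ≤ l → l ≤ s j → ⊢ pos (yv j l)

    true-input-derived j j≤m l∈ with ∈-trueInputs⁻ j l∈
    true-input-derived zero    j≤m l∈ | l∈X , τ⊨l = true-x-given l∈X τ⊨l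
    true-input-derived (suc j) j<m l∈ | l∈inputs , τ⊨l with ∈-++⁻ (ys j) l∈inputs
    ... | inj₂ l∈X = true-x-given l∈X τ⊨l
    ... | inj₁ l∈y with ∈-map⁻ (λ l → pos (yv j (b * l))) l∈y
    ... | l , l∈range , refl =
      y-true j (<⇒≤ j<m) (*-mono-≤ (>-nonZero⁻¹ b) (proj₁ (∈-range1⁻ l∈range))) (≤ᵇ≡true⇒≤ τ⊨l)

    y-true j j≤m {l} 1≤l l≤s =
      via-network j≤m (trueInputs j) (trueInputs-in-scope j) (true-input-derived j j≤m) (pos (yv j l))
        (inj₂ (l , 1≤l , l≤e , refl)) true-inputs⊨y
      where
      l≤e : l ≤ e j
      l≤e = ≤-trans l≤s (s≤e j)
      true-inputs⊨y : ∀ σ → σ ⊨ᵃ trueInputs j → SortRel j σ → σ ⊨ˡ pos (yv j l)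
      true-inputs⊨y σ σ⊨ sorted = Equivalence.from (sorted l 1≤l l≤e) (≤-trans l≤s
        (subst (_≤ countTrue σ (inputs j)) (countTrue-inputs j)
               (countTrue-mono τ σ (inputs j) (trueInputs-extends j σ⊨))))

    false-input-refuted : ∀ {j} → j ≤ m → Refuted j (suc (s j)) →
                          ∀ {l} → l ∈ inputs j → evalLit τ l ≡ false → ⊢ negate l
    false-input-refuted {j} j≤m refuted {l} l∈ τl with suc (s j) ≤? e j
    ... | yes in-range =
      via-network j≤m (neg (yv j (suc (s j))) ∷ trueInputs j)
        (inj₂ (suc (s j) , s≤s z≤n , in-range , refl) ∷ trueInputs-in-scope j) ⊢α
        (negate l) (negated-input-in-scope l∈) α⊨¬l
      where
      ⊢α : ∀ {l′} → l′ ∈ neg (yv j (suc (s j))) ∷ trueInputs j → ⊢ l′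
      ⊢α (here refl) = refuted in-range
      ⊢α (there l′∈) = true-input-derived j j≤m l′∈
      α⊨¬l : ∀ σ → σ ⊨ᵃ (neg (yv j (suc (s j))) ∷ trueInputs j) → SortRel j σ → σ ⊨ˡ negate l
      α⊨¬l σ (σ⊨¬y ∷ σ⊨) sorted =
        at-most-s⊨false-inputs j σ⊨ (≤-pred (output-false⇒count< j sorted (s≤s z≤n) in-range σ⊨¬y)) l∈ τl
    ... | no out-of-range =
      via-network j≤m (trueInputs j) (trueInputs-in-scope j) (true-input-derived j j≤m)
        (negate l) (negated-input-in-scope l∈)
        λ σ σ⊨ _ → at-most-s⊨false-inputs j σ⊨
                     (≤-trans (countTrue≤length σ (inputs j)) (≤-pred (≰⇒> out-of-range))) l∈ τl

    s-split : ∀ {j} → j ≤ m → s j ≡ ε j + s j / b * b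
    s-split {j} j≤m = trans (m≡m%n+[m/n]*n (s j) b) (cong (_+ s j / b * b) (s-digits j j≤m))

    b+q*b≡b*[1+q] : ∀ q → b + q * b ≡ b * suc q
    b+q*b≡b*[1+q] q = trans (cong (b +_) (*-comm q b)) (sym (*-suc b q))

    s+b∸ε≡nextMultiple : ∀ {j} → j ≤ m → s j + b ∸ ε j ≡ nextMultiple j
    s+b∸ε≡nextMultiple {j} j≤m = begin
      s j + b ∸ ε j                   ≡⟨ cong (λ t → t + b ∸ ε j) (s-split j≤m) ⟩
      ε j + s j / b * b + b ∸ ε j     ≡⟨ cong (_∸ ε j) (+-assoc (ε j) _ b) ⟩
      ε j + (s j / b * b + b) ∸ ε j   ≡⟨ m+n∸m≡n (ε j) _ ⟩
      s j / b * b + b                 ≡⟨ +-comm _ b ⟩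
      b + s j / b * b                 ≡⟨ b+q*b≡b*[1+q] (s j / b) ⟩
      nextMultiple j                  ∎
      where open ≡-Reasoning

    oε-true-given : ∀ {j} → j ≤ m → Refuted j (nextMultiple j) → 0 < ε j → ⊢ pos (ov j (ε j))
    oε-true-given {j} j≤m refuted 0<ε =
      o-true (t-true (y-true j j≤m 1≤s ≤-refl) (subst (Refuted j) (sym (s+b∸ε≡nextMultiple j≤m)) refuted))
      where
      1≤s : 1 ≤ s j
      1≤s = ≤-trans 0<ε (subst (_≤ s j) (s-digits j j≤m) (m%n≤m (s j) b))
      open Tseytin j≤m 0<ε (ε<b j j≤m)
        (∈-idx j 1≤s (s≤e j) (trans (s-digits j j≤m) (sym (m<n⇒m%n≡m (ε<b j j≤m)))))

    oε+1-false-given : ∀ {j} → j ≤ m → (∀ k → j < k → k ≤ m → 0 < ε k → ⊢ pos (ov k (ε k))) →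
                       suc (ε j) < b → ⊢ neg (ov j (suc (ε j)))
    oε+1-false-given {j} j≤m later-oε-true εj+1<b =
      propagate [] _ (finalClause∈snOpt j≤m εj+1<b) [] (All.map⁺ (All.tabulate later))
      where
      later : ∀ {k} → k ∈ filterᵇ (λ k → (j <ᵇ k) ∧ (0 <ᵇ ε k)) (upTo (suc m)) → ⊢ pos (ov k (ε k))
      later k∈ with ∈-filter⁻ (λ k → T? ((j <ᵇ k) ∧ (0 <ᵇ ε k))) k∈
      ... | k∈upTo , j<k∧0<εk with Equivalence.to T-∧ j<k∧0<εk
      ... | j<k , 0<εk = later-oε-true _ (<ᵇ⇒< j _ j<k) (≤-pred (∈-upTo⁻ k∈upTo)) (<ᵇ⇒< 0 _ 0<εk)

    refuted-above-count : ∀ {j} → j ≤ m → Refuted j (nextMultiple j) →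
                          (suc (ε j) < b → ⊢ neg (ov j (suc (ε j)))) → Refuted j (suc (s j))
    refuted-above-count {j} j≤m refuted oε+1-false in-range with suc (ε j) <? b
    ... | no εj+1≮b = subst (Refuted j) (sym s+1≡nextMultiple) refuted in-range
      where
      s+1≡nextMultiple : suc (s j) ≡ nextMultiple j
      s+1≡nextMultiple = begin
        suc (s j)                ≡⟨ cong suc (s-split j≤m) ⟩
        suc (ε j) + s j / b * b  ≡⟨ cong (_+ s j / b * b) (≤-antisym (ε<b j j≤m) (≮⇒≥ εj+1≮b)) ⟩
        b + s j / b * b          ≡⟨ b+q*b≡b*[1+q] (s j / b) ⟩
        nextMultiple j           ∎
        where open ≡-Reasoning
    ... | yes εj+1<b =
      -- y-false needs Refuted j (suc (s j) + b ∸ suc (ε j)), which reduces to Refuted j (s j + b ∸ ε j).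
      y-false (t-false (oε+1-false εj+1<b)) (subst (Refuted j) (sym (s+b∸ε≡nextMultiple j≤m)) refuted)
      where
      s+1≡ε+1 : suc (s j) % b ≡ suc (ε j) % b
      s+1≡ε+1 = trans (cong (λ t → suc t % b) (s-split j≤m)) ([m+kn]%n≡m%n (suc (ε j)) (s j / b) b)
      open Tseytin j≤m (s≤s z≤n) εj+1<b (∈-idx j (s≤s z≤n) in-range s+1≡ε+1)

    refuted-below : ∀ {j} → suc j ≤ m → Refuted (suc j) (suc (s (suc j))) → Refuted j (nextMultiple j)
    refuted-below {j} j<m refuted in-range =
      false-input-refuted j<m refuted
        (∈-++⁺ˡ (∈-map⁺ (λ l → pos (yv j (b * l))) (∈-range1⁺ (s≤s z≤n) (*≤⇒≤/ b in-range))))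
        (≰⇒≤ᵇ≡false (λ b[q+1]≤s → n≮n (s j / b) (*≤⇒≤/ b b[q+1]≤s)))

    refuted-top : Refuted m (nextMultiple m)
    refuted-top in-range =
      ⊥-elim (<⇒≱ (subst (_< b) (sym (e≡carry m)) carry-d-top)
                  (≤-trans (m≤m*n b (suc (s m / b))) in-range))

    refuted-next-multiple : ∀ j → j ≤ m → Refuted j (nextMultiple j)
    refuted-next-multiple = downward-induction (λ j → Refuted j (nextMultiple j)) m step
      where
      step : ∀ j → j ≤ m → (∀ k → j < k → k ≤ m → Refuted k (nextMultiple k)) → Refuted j (nextMultiple j)
      step j j≤m above with m≤n⇒m<n∨m≡n j≤m
      ... | inj₂ refl = refuted-top
      ... | inj₁ j<m  = refuted-below j<m (refuted-above-count j<m (above (suc j) ≤-refl j<m)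
        (oε+1-false-given j<m λ k j+1<k k≤m → oε-true-given k≤m (above k (<-trans (n<1+n j) j+1<k) k≤m)))

    oε-true : ∀ j → j ≤ m → 0 < ε j → ⊢ pos (ov j (ε j))
    oε-true j j≤m = oε-true-given j≤m (refuted-next-multiple j j≤m)

    oε+1-false : ∀ j → j ≤ m → suc (ε j) < b → ⊢ neg (ov j (suc (ε j)))
    oε+1-false j j≤m = oε+1-false-given j≤m (λ k _ k≤m → oε-true k k≤m)

    x-above-v-false : ∀ i → Σ ℕ (λ j → j ≤ m × A i j ≢ 0) → v i < d i → ⊢ neg (xv i (suc (v i)))
    x-above-v-false i (j , j≤m , Aij≢0) v<d =
      false-input-refuted j≤m (refuted-above-count j≤m (refuted-next-multiple j j≤m) (oε+1-false j j≤m))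
        (Xs⊆inputs j (∈-concat⁺′ (∈-concat⁺′ (∈-replicate⁺ (A i j) Aij≢0)
                                              (∈-map⁺ (λ k → replicate (A i j) (pos (xv i k))) (∈-range1⁺ (s≤s z≤n) v<d)))
                                 (∈-map⁺ (λ i → X i j) (∈-allFin i))))
        (≰⇒≤ᵇ≡false (n≮n (v i)))

lemma3 : (n b m : ℕ) → {{_ : NonZero b}} → 1 < b →
    (a : Fin n → ℕ) (a₀ : ℕ) (d : Fin n → ℕ) →
    sumFin n (λ i → a i * d i) < b ^ suc m → a₀ < b ^ suc m →
    (A : Fin n → ℕ → ℕ) (ε : ℕ → ℕ) →
    (∀ i j → j ≤ m → A i j < b) → (∀ j → j ≤ m → ε j < b) →
    (∀ i → a i ≡ sumTo m (λ j → b ^ j * A i j)) →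
    a₀ ≡ sumTo m (λ j → b ^ j * ε j) →
    (v : Fin n → ℕ) → (∀ i → v i ≤ d i) →
    sumTo m (λ j → sumFin n (λ i → b ^ j * A i j * v i)) ≡ sumTo m (λ j → b ^ j * ε j) →
    (W : Set) (nets : ℕ → CNF (Var n W)) →
    (∀ j → j ≤ m → SNOpt.IsSN n b m d A ε W j (nets j)) →
    (∀ j → j ≤ m → 0 < ε j →
       UP SNOpt.snOpt n b m d A ε W nets , SNOpt.assignA n b m d A ε W v
          ⊢ pos (ov j (ε j)))
    × (∀ j → j ≤ m → suc (ε j) < b →
       UP SNOpt.snOpt n b m d A ε W nets , SNOpt.assignA n b m d A ε W v
          ⊢ neg (ov j (suc (ε j))))
    × (∀ i → Σ ℕ (λ j → j ≤ m × A i j ≢ 0) → v i < d i →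
       UP SNOpt.snOpt n b m d A ε W nets , SNOpt.assignA n b m d A ε W v
          ⊢ neg (xv i (suc (v i))))
lemma3 n b m _ a _ d a·d<b^m+1 _ A ε _ ε<b a-digits _ v v≤d balance W nets isSN =
  oε-true , oε+1-false , x-above-v-false
  where
  open Propagation n b m d A ε W nets v v≤d
  s-digits : ∀ j → j ≤ m → s j % b ≡ ε j
  s-digits = carry-digits b m (colSum n A v) ε ε<b
    (trans (sum-map-cong (upTo (suc m)) (λ j → sym (sumFin-column n A v (b ^ j) j))) balance)
  carry-d-top : carry b (colSum n A d) m < b
  carry-d-top = carry-top< b m (colSum n A d)
    (subst (_< b ^ suc m) (sumFin-expand n A d b m a a-digits) a·d<b^m+1)
  open Derivations isSN ε<b s-digits carry-d-top
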